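{- For every integer $m\geqslant4$, $$\mathcal{D}_m=\frac12\cdot\frac{1}{2\uparrow\uparrow m}+O\!\left(\frac{1}{3^{2\uparrow\uparrow(m-1)}}\right),$$ where the absolute value of the constant implied by the $O$-symbol does not exceed $3$.
   Context: For a positive integer $n$ the height $H(n)$ is defined recursively. Set $H(1)=0$. If $n>1$ has canonical factorization $n=p_1^{a_1}\cdots p_k^{a_k}$ (distinct primes, $a_i\geqslant1$), set $H(n)=1+\max_iH(a_i)$. Tetration: $a\uparrow\uparrow0=1$ and $a\uparrow\uparrow(b+1)=a^{a\uparrow\uparrow b}$. For $k\geqslant1$ let $D_k$ be the natural density of $\{n\geqslant1:H(n)\geqslant k\}$. Equivalently, $D_1=1$ and, for $k\geqslant2$, $$D_k=1-\prod_p\left(1+\sum_{\alpha\geqslant1}\frac{f_{k-1}(p^\alpha)-f_{k-1}(p^{\alpha-1})}{p^\alpha}\right),$$ where $f_j(n)=1$ if $H(n)\leqslant j$ and $0$ otherwise. Set $\mathcal{D}_k=D_k-D_{k+1}$, the natural density of $\{n:H(n)=k\}$. -}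

module Defs where

open import Data.Nat using (ℕ; zero; suc; _+_; _*_; _∸_; _^_; _⊔_; _≤?_; _≟_; NonZero)
open import Data.Nat.Properties using (m^n≢0; m*n≢0)
open import Data.Nat.Divisibility using (_∣?_)
open import Data.Nat.Primality using (prime?)
open import Data.Integer using (+_)
open import Data.Rational using (ℚ; _/_)
open import Data.List using (List; []; _∷_; foldr; map; filter; upTo)
open import Relation.Nullary.Decidable using (does; _×-dec_)
open import Data.Bool using (if_then_else_)

infixr 8 _↑↑_
_↑↑_ : ℕ → ℕ → ℕ
a ↑↑ zero  = 1
a ↑↑ suc b = a ^ (a ↑↑ b)

2↑↑-nonZero : ∀ b → NonZero (2 ↑↑ b)
2↑↑-nonZero zero    = _
2↑↑-nonZero (suc b) = m^n≢0 2 (2 ↑↑ b)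

maximum : List ℕ → ℕ
maximum = foldr _⊔_ 0

-- exponent of p in n (for p ≥ 2, n ≥ 1): the largest a ≤ n with p ^ a ∣ n
-- (divisibility by p ^ a is downward closed in a, so this is the p-adic valuation)
val : ℕ → ℕ → ℕ
val p n = maximum (map (λ a → if does ((p ^ a) ∣? n) then a else 0) (upTo (suc n)))

-- prime divisors of n (all of them are ≤ n when n ≥ 1)
primeDivisors : ℕ → List ℕ
primeDivisors n = filter (λ p → prime? p ×-dec (p ∣? n)) (upTo (suc n))

-- height with fuel; the exponents a_i of n > 1 satisfy a_i < n, so fuel n suffices
heightF : ℕ → ℕ → ℕ
heightF zero    n = 0
heightF (suc f) n =
  if does (n ≤? 1) then 0
  else suc (maximum (map (λ p → heightF f (val p n)) (primeDivisors n)))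

-- H(1) = 0, H(n) = 1 + max_i H(a_i) for n = ∏ p_i ^ a_i > 1
H : ℕ → ℕ
H n = heightF n n

countH : ℕ → ℕ → ℕ
countH k zero    = 0
countH k (suc N) = countH k N + (if does (H (suc N) ≟ k) then 1 else 0)

-- proportion of n ∈ {1, …, N+1} with H(n) = k
propH : ℕ → ℕ → ℚ
propH k N = (+ countH k (suc N)) / suc N

mainTerm : ℕ → ℚ
mainTerm m = _/_ (+ 1) (2 * (2 ↑↑ m)) {{m*n≢0 2 (2 ↑↑ m) {{_}} {{2↑↑-nonZero m}}}}

errBound : ℕ → ℚ
errBound m = _/_ (+ 3) (3 ^ (2 ↑↑ (m ∸ 1))) {{m^n≢0 3 (2 ↑↑ (m ∸ 1))}}

module Submission where

-- For j ≥ 1, H(n) ≥ j + 1 iff H(v_p(n)) ≥ j for some prime p. Hence, off the sparse set of n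
-- divisible by p^(C+1) for a prime p ≤ P or by d² for some d > P, whether H(n) = m depends only
-- on n modulo ∏_{d ≤ P} d^(C+1); such a periodic set has a density and the exceptional set has
-- upper density at most (P - 1)/2^(C+1) + 1/P, so the proportions are Cauchy.
-- For the main term let A = 2↑↑(m-1), so that H(a) ≥ m - 1 forces a = A or a ≥ 2A. If v_2(n) = A
-- and no d^(2^A) with d ≥ 2 divides n, then H(n) = m; conversely H(n) = m forces v_2(n) = A, or
-- 2^(2A) | n, or d^A | n for some d ≥ 3. The first set has density 1/(2·2^A); all the others
-- together have density at most 3/3^A.

open import Defs

module Fractions where

  open import Data.Nat as ℕ using (ℕ; zero; suc; NonZero; s≤s; z≤n)
  import Data.Nat.Properties as ℕP
  open import Data.Integer as ℤ using (+_)
  import Data.Integer.Properties as ℤP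
  open import Data.Rational hiding (NonZero)
  open import Data.Rational.Properties
  open import Data.Rational.Unnormalised as ℚᵘ using (mkℚᵘ; *≤*)
  import Data.Rational.Unnormalised.Properties as ℚᵘP
  open import Algebra.Properties.Group +-0-group using (//-rightDividesʳ; ⁻¹-anti-homo-//)
  open import Relation.Binary.PropositionalEquality
  open import Data.Sum using (inj₁; inj₂)
  open import Data.Product using (_×_; _,_; ∃-syntax)
  open import Data.Nat.Tactic.RingSolver using (solve-∀)

  private
    toℚᵘ-/ : ∀ a b → toℚᵘ ((+ a) / suc b) ℚᵘ.≃ mkℚᵘ (+ a) b
    toℚᵘ-/ a b = toℚᵘ-fromℚᵘ (mkℚᵘ (+ a) b)

  /≤/ : ∀ a b c d .{{_ : NonZero b}} .{{_ : NonZero d}} → a ℕ.* d ℕ.≤ c ℕ.* b → (+ a) / b ≤ (+ c) / d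
  /≤/ a (suc b) c (suc d) ad≤cb = toℚᵘ-cancel-≤
    (ℚᵘP.≤-respˡ-≃ (ℚᵘP.≃-sym (toℚᵘ-/ a b)) (ℚᵘP.≤-respʳ-≃ (ℚᵘP.≃-sym (toℚᵘ-/ c d))
      (*≤* (subst₂ ℤ._≤_ (ℤP.pos-* a (suc d)) (ℤP.pos-* c (suc b)) (ℤ.+≤+ ad≤cb)))))

  /+/ : ∀ a b c d .{{_ : NonZero b}} .{{_ : NonZero d}} →
        (+ a) / b + (+ c) / d ≡ _/_ (+ (a ℕ.* d ℕ.+ c ℕ.* b)) (b ℕ.* d) {{ℕP.m*n≢0 b d}}
  /+/ a (suc b) c (suc d) = toℚᵘ-injective (begin-equality
      toℚᵘ ((+ a) / suc b + (+ c) / suc d)   ≃⟨ toℚᵘ-homo-+ ((+ a) / suc b) ((+ c) / suc d) ⟩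
      toℚᵘ ((+ a) / suc b) ℚᵘ.+ toℚᵘ ((+ c) / suc d)  ≃⟨ ℚᵘP.+-cong (toℚᵘ-/ a b) (toℚᵘ-/ c d) ⟩
      mkℚᵘ (+ a) b ℚᵘ.+ mkℚᵘ (+ c) d          ≃⟨ ℚᵘP.≃-refl ⟩
      mkℚᵘ (+ a ℤ.* + suc d ℤ.+ + c ℤ.* + suc b) (d ℕ.+ b ℕ.* suc d)
        ≡⟨ cong (λ n → mkℚᵘ n (d ℕ.+ b ℕ.* suc d)) numerator ⟩
      mkℚᵘ (+ (a ℕ.* suc d ℕ.+ c ℕ.* suc b)) (d ℕ.+ b ℕ.* suc d)  ≃⟨ ℚᵘP.≃-sym (toℚᵘ-/ _ _) ⟩
      toℚᵘ ((+ (a ℕ.* suc d ℕ.+ c ℕ.* suc b)) / (suc b ℕ.* suc d)) ∎)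
    where
    open ℚᵘP.≤-Reasoning
    numerator : + a ℤ.* + suc d ℤ.+ + c ℤ.* + suc b ≡ + (a ℕ.* suc d ℕ.+ c ℕ.* suc b)
    numerator = trans (cong₂ ℤ._+_ (sym (ℤP.pos-* a (suc d))) (sym (ℤP.pos-* c (suc b))))
                      (sym (ℤP.pos-+ (a ℕ.* suc d) (c ℕ.* suc b)))

  /≤/+1/ : ∀ a b c d e Q .{{_ : NonZero b}} .{{_ : NonZero d}} .{{_ : NonZero Q}} →
           a ℕ.* d ℕ.≤ c ℕ.* b ℕ.+ e → e ℕ.* Q ℕ.≤ b ℕ.* d → (+ a) / b ≤ (+ c) / d + (+ 1) / Q
  /≤/+1/ a b c d e Q {{b≢0}} ad≤cb+e eQ≤bd = subst (λ x → (+ a) / b ≤ x) (sym (/+/ c d 1 Q))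
    (/≤/ a b (c ℕ.* Q ℕ.+ 1 ℕ.* d) (d ℕ.* Q) {{b≢0}} {{ℕP.m*n≢0 d Q}} (begin
      a ℕ.* (d ℕ.* Q)            ≡⟨ ℕP.*-assoc a d Q ⟨
      a ℕ.* d ℕ.* Q              ≤⟨ ℕP.*-monoˡ-≤ Q ad≤cb+e ⟩
      (c ℕ.* b ℕ.+ e) ℕ.* Q      ≡⟨ ℕP.*-distribʳ-+ Q (c ℕ.* b) e ⟩
      c ℕ.* b ℕ.* Q ℕ.+ e ℕ.* Q  ≤⟨ ℕP.+-monoʳ-≤ (c ℕ.* b ℕ.* Q) eQ≤bd ⟩
      c ℕ.* b ℕ.* Q ℕ.+ b ℕ.* d  ≡⟨ identity c b Q d ⟩
      (c ℕ.* Q ℕ.+ 1 ℕ.* d) ℕ.* b ∎))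
    where
    open ℕP.≤-Reasoning
    identity : ∀ c b Q d → c ℕ.* b ℕ.* Q ℕ.+ b ℕ.* d ≡ (c ℕ.* Q ℕ.+ 1 ℕ.* d) ℕ.* b
    identity = solve-∀

  +/-distrib : ∀ a b c .{{_ : NonZero c}} → (+ (a ℕ.+ b)) / c ≡ (+ a) / c + (+ b) / c
  +/-distrib a b c {{c≢0}} = trans
    (≤-antisym (/≤/ (a ℕ.+ b) c (a ℕ.* c ℕ.+ b ℕ.* c) (c ℕ.* c) {{c≢0}} {{c²≢0}} (ℕP.≤-reflexive (identity a b c)))
               (/≤/ (a ℕ.* c ℕ.+ b ℕ.* c) (c ℕ.* c) (a ℕ.+ b) c {{c²≢0}} {{c≢0}} (ℕP.≤-reflexive (sym (identity a b c)))))
    (sym (/+/ a c b c))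
    where
    c²≢0 = ℕP.m*n≢0 c c
    identity : ∀ a b c → (a ℕ.+ b) ℕ.* (c ℕ.* c) ≡ (a ℕ.* c ℕ.+ b ℕ.* c) ℕ.* c
    identity = solve-∀

  1/suc≤pos : ∀ ε → 0ℚ < ε → ∃[ k ] (+ 1) / suc k ≤ ε
  1/suc≤pos (mkℚ (+ suc n) d _) _ = d , toℚᵘ-cancel-≤ (ℚᵘP.≤-respˡ-≃ (ℚᵘP.≃-sym (toℚᵘ-/ 1 d))
    (*≤* (ℤ.+≤+ (ℕP.*-monoˡ-≤ (suc d) {1} {suc n} (s≤s z≤n)))))
  1/suc≤pos (mkℚ (+ zero) d _) (*<* (ℤ.+<+ ()))
  1/suc≤pos (mkℚ ℤ.-[1+ n ] d _) (*<* ())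

  Within : ℚ → ℚ → ℚ → Set
  Within e x y = x ≤ y + e × y ≤ x + e

  Within-sym : ∀ {e x y} → Within e x y → Within e y x
  Within-sym (x≤y+e , y≤x+e) = y≤x+e , x≤y+e

  Within-trans : ∀ {e e′ x y z} → Within e x y → Within e′ y z → Within (e + e′) x z
  Within-trans {e} {e′} {x} {y} {z} (x≤y+e , y≤x+e) (y≤z+e′ , z≤y+e′) =
      (begin x ≤⟨ x≤y+e ⟩ y + e ≤⟨ +-monoˡ-≤ e y≤z+e′ ⟩ z + e′ + e ≡⟨ +-assoc z e′ e ⟩
             z + (e′ + e) ≡⟨ cong (λ w → z + w) (+-comm e′ e) ⟩ z + (e + e′) ∎)
    , (begin z ≤⟨ z≤y+e′ ⟩ y + e′ ≤⟨ +-monoˡ-≤ e′ y≤x+e ⟩ x + e + e′ ≡⟨ +-assoc x e e′ ⟩ x + (e + e′) ∎)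
    where open ≤-Reasoning

  Within-mono : ∀ {e e′ x y} → e ≤ e′ → Within e x y → Within e′ x y
  Within-mono {x = x} {y} e≤e′ (x≤y+e , y≤x+e) =
    ≤-trans x≤y+e (+-monoʳ-≤ y e≤e′) , ≤-trans y≤x+e (+-monoʳ-≤ x e≤e′)

  p≤q+r⇒p-q≤r : ∀ {p q r} → p ≤ q + r → p - q ≤ r
  p≤q+r⇒p-q≤r {p} {q} {r} p≤q+r =
    subst (p - q ≤_) (trans (cong (_- q) (+-comm q r)) (//-rightDividesʳ q r)) (+-monoˡ-≤ (- q) p≤q+r)

  Within⇒∣-∣≤ : ∀ {e x y} → Within e x y → ∣ x - y ∣ ≤ e
  Within⇒∣-∣≤ {e} {x} {y} (x≤y+e , y≤x+e) with ∣p∣≡p∨∣p∣≡-p (x - y)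
  ... | inj₁ ∣x-y∣≡x-y = subst (_≤ e) (sym ∣x-y∣≡x-y) (p≤q+r⇒p-q≤r x≤y+e)
  ... | inj₂ ∣x-y∣≡y-x = subst (_≤ e) (sym (trans ∣x-y∣≡y-x (⁻¹-anti-homo-// x y))) (p≤q+r⇒p-q≤r y≤x+e)

  half+half≤1/ : ∀ K .{{_ : NonZero K}} →
    _/_ (+ 1) (2 ℕ.* K) {{ℕP.m*n≢0 2 K}} + _/_ (+ 1) (2 ℕ.* K) {{ℕP.m*n≢0 2 K}} ≤ (+ 1) / K
  half+half≤1/ K = subst (_≤ (+ 1) / K) (+/-distrib 1 1 (2 ℕ.* K) {{ℕP.m*n≢0 2 K}})
    (/≤/ 2 (2 ℕ.* K) 1 K {{ℕP.m*n≢0 2 K}} (ℕP.≤-reflexive (sym (ℕP.*-identityˡ (2 ℕ.* K)))))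

  cauchy-if-approximable : (x : ℕ → ℚ) →
    (∀ K → ∃[ δ ] ∃[ N₀ ] ∀ N → N₀ ℕ.≤ N → Within ((+ 1) / (2 ℕ.* suc K)) (x N) δ) →
    ∀ ε → 0ℚ < ε → ∃[ N₀ ] ∀ N N′ → N₀ ℕ.≤ N → N₀ ℕ.≤ N′ → ∣ x N - x N′ ∣ ≤ ε
  cauchy-if-approximable x approx ε ε>0 with 1/suc≤pos ε ε>0
  ... | K , 1/K≤ε with approx K
  ...   | δ , N₀ , near = N₀ , λ N N′ N₀≤N N₀≤N′ → Within⇒∣-∣≤
          (Within-mono (≤-trans (half+half≤1/ (suc K)) 1/K≤ε)
            (Within-trans (near N N₀≤N) (Within-sym (near N′ N₀≤N′))))

module Counting where

  open import Data.Nat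
  open import Data.Nat.Properties
  open import Data.Nat.DivMod
  open import Data.Nat.Divisibility
  open import Data.Nat.Tactic.RingSolver using (solve-∀)
  open import Algebra.Properties.CommutativeSemigroup +-commutativeSemigroup using () renaming (interchange to +-interchange)
  open import Data.Bool using (if_then_else_)
  open import Data.Empty using (⊥-elim)
  open import Data.Product using (_×_; _,_; ∃-syntax; proj₁; proj₂)
  open import Data.Sum using (inj₁; inj₂)
  open import Level using (0ℓ)
  open import Relation.Binary.PropositionalEquality
  open import Relation.Nullary using (Dec; yes; no; does; ¬_; ¬?; _⊎-dec_; _×-dec_)
  open import Relation.Unary using (Pred; Decidable; _∪_)
  open import Relation.Unary.Properties using (_∪?_; _∩?_; ∁?)

  𝟙 : {A : Set} → Dec A → ℕ
  𝟙 a = if does a then 1 else 0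

  -- the number of n ∈ [1, L] (not [0, L)) with P n
  count : {P : Pred ℕ 0ℓ} → Decidable P → ℕ → ℕ
  count P? zero    = 0
  count P? (suc L) = count P? L + 𝟙 (P? (suc L))

  _⊆[1,_]_ : Pred ℕ 0ℓ → ℕ → Pred ℕ 0ℓ → Set
  P ⊆[1, L ] Q = ∀ {n} → 0 < n → n ≤ L → P n → Q n

  private
    variable
      P Q R : Pred ℕ 0ℓ

    𝟙≤1 : {A : Set} (a : Dec A) → 𝟙 a ≤ 1
    𝟙≤1 (yes _) = ≤-refl
    𝟙≤1 (no _)  = z≤n

    𝟙-mono : {A B : Set} → (A → B) → (a : Dec A) (b : Dec B) → 𝟙 a ≤ 𝟙 b
    𝟙-mono f (no _)  _       = z≤n
    𝟙-mono f (yes a) (yes _) = ≤-refl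
    𝟙-mono f (yes a) (no ¬b) = ⊥-elim (¬b (f a))

    ⊆[1,suc]⇒⊆[1,] : ∀ {L} → P ⊆[1, suc L ] Q → P ⊆[1, L ] Q
    ⊆[1,suc]⇒⊆[1,] P⊆Q 0<n n≤L = P⊆Q 0<n (m≤n⇒m≤1+n n≤L)

  count≤ : (P? : Decidable P) → ∀ L → count P? L ≤ L
  count≤ P? zero    = z≤n
  count≤ P? (suc L) = subst (count P? L + 𝟙 (P? (suc L)) ≤_) (+-comm L 1) (+-mono-≤ (count≤ P? L) (𝟙≤1 (P? (suc L))))

  count-mono : (P? : Decidable P) (Q? : Decidable Q) → ∀ {L} → P ⊆[1, L ] Q → count P? L ≤ count Q? L
  count-mono P? Q? {zero}  P⊆Q = z≤n
  count-mono P? Q? {suc L} P⊆Q =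
    +-mono-≤ (count-mono P? Q? (⊆[1,suc]⇒⊆[1,] P⊆Q)) (𝟙-mono (P⊆Q (s≤s z≤n) ≤-refl) (P? (suc L)) (Q? (suc L)))

  count-cong : (P? : Decidable P) (Q? : Decidable Q) → ∀ {L} → P ⊆[1, L ] Q → Q ⊆[1, L ] P → count P? L ≡ count Q? L
  count-cong P? Q? P⊆Q Q⊆P = ≤-antisym (count-mono P? Q? P⊆Q) (count-mono Q? P? Q⊆P)

  count-∅ : (P? : Decidable P) → (∀ {n} → ¬ P n) → ∀ L → count P? L ≡ 0
  count-∅ P? ¬P zero    = refl
  count-∅ P? ¬P (suc L) with P? (suc L)
  ... | yes p = ⊥-elim (¬P p)
  ... | no _  = trans (+-identityʳ _) (count-∅ P? ¬P L)

  count-∪ : (P? : Decidable P) (Q? : Decidable Q) → ∀ L → count (P? ∪? Q?) L ≤ count P? L + count Q? L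
  count-∪ P? Q? zero    = z≤n
  count-∪ P? Q? (suc L) = begin
    count (P? ∪? Q?) L + 𝟙 ((P? ∪? Q?) (suc L))   ≤⟨ +-mono-≤ (count-∪ P? Q? L) (𝟙-∪ (P? (suc L)) (Q? (suc L))) ⟩
    (count P? L + count Q? L) + (p + q)            ≡⟨ +-interchange (count P? L) (count Q? L) p q ⟩
    (count P? L + p) + (count Q? L + q)            ∎
    where
    open ≤-Reasoning
    p = 𝟙 (P? (suc L))
    q = 𝟙 (Q? (suc L))
    𝟙-∪ : {A B : Set} (a : Dec A) (b : Dec B) → 𝟙 (a ⊎-dec b) ≤ 𝟙 a + 𝟙 b
    𝟙-∪ (yes _) _ = s≤s z≤n
    𝟙-∪ (no _)  _ = ≤-refl

  count-cover : (P? : Decidable P) (Q? : Decidable Q) (R? : Decidable R) → ∀ {L} →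
                P ⊆[1, L ] (Q ∪ R) → count P? L ≤ count Q? L + count R? L
  count-cover P? Q? R? {L} P⊆Q∪R = ≤-trans (count-mono P? (Q? ∪? R?) P⊆Q∪R) (count-∪ Q? R? L)

  count-∖ : (P? : Decidable P) (Q? : Decidable Q) → (∀ {n} → Q n → P n) → ∀ L →
            count (P? ∩? ∁? Q?) L + count Q? L ≡ count P? L
  count-∖ P? Q? Q⊆P zero    = refl
  count-∖ {P = P} {Q = Q} P? Q? Q⊆P (suc L) = begin
    (count (P? ∩? ∁? Q?) L + 𝟙 ((P? ∩? ∁? Q?) (suc L))) + (count Q? L + 𝟙 (Q? (suc L)))
      ≡⟨ +-interchange (count (P? ∩? ∁? Q?) L) _ (count Q? L) _ ⟩
    (count (P? ∩? ∁? Q?) L + count Q? L) + (𝟙 ((P? ∩? ∁? Q?) (suc L)) + 𝟙 (Q? (suc L)))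
      ≡⟨ cong₂ _+_ (count-∖ P? Q? Q⊆P L) (𝟙-∖ (P? (suc L)) (Q? (suc L))) ⟩
    count P? L + 𝟙 (P? (suc L)) ∎
    where
    open ≡-Reasoning
    𝟙-∖ : ∀ {n} (p : Dec (P n)) (q : Dec (Q n)) → 𝟙 (p ×-dec ¬? q) + 𝟙 q ≡ 𝟙 p
    𝟙-∖ (yes _) (yes _) = refl
    𝟙-∖ (yes _) (no _)  = refl
    𝟙-∖ (no _)  (no _)  = refl
    𝟙-∖ (no ¬p) (yes q) = ⊥-elim (¬p (Q⊆P q))

  count-shift : (P? : Decidable P) → ∀ L K → count P? (L + K) ≡ count P? L + count (λ n → P? (L + n)) K
  count-shift P? L zero    = trans (cong (count P?) (+-identityʳ L)) (sym (+-identityʳ _))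
  count-shift P? L (suc K) = begin
    count P? (L + suc K)                                          ≡⟨ cong (count P?) (+-suc L K) ⟩
    count P? (L + K) + 𝟙 (P? (suc (L + K)))                        ≡⟨ cong (_+ 𝟙 (P? (suc (L + K)))) (count-shift P? L K) ⟩
    count P? L + count (λ n → P? (L + n)) K + 𝟙 (P? (suc (L + K)))  ≡⟨ +-assoc (count P? L) _ _ ⟩
    count P? L + (count (λ n → P? (L + n)) K + 𝟙 (P? (suc (L + K))))
      ≡⟨ cong (λ m → count P? L + (count (λ n → P? (L + n)) K + 𝟙 (P? m))) (sym (+-suc L K)) ⟩
    count P? L + count (λ n → P? (L + n)) (suc K) ∎
    where open ≡-Reasoning

  module Residues {Q : Pred ℕ 0ℓ} (Q? : Decidable Q) (M : ℕ) .{{_ : NonZero M}} where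

    inClass? : Decidable (λ n → Q (n % M))
    inClass? n = Q? (n % M)

    private
      c = count inClass? M

      count-shift-period : ∀ x → count (λ n → inClass? (M + n)) x ≡ count inClass? x
      count-shift-period x = count-cong (λ n → inClass? (M + n)) inClass? {x}
        (λ {n} _ _ → subst Q (M+n%M≡n%M n)) (λ {n} _ _ → subst Q (sym (M+n%M≡n%M n)))
        where
        M+n%M≡n%M : ∀ n → (M + n) % M ≡ n % M
        M+n%M≡n%M n = trans (cong (_% M) (+-comm M n)) ([m+n]%n≡m%n n M)

      count-blocks : ∀ k r → count inClass? (k * M + r) ≡ k * c + count inClass? r
      count-blocks zero    r = refl
      count-blocks (suc k) r = begin
        count inClass? (M + k * M + r)                                ≡⟨ cong (count inClass?) (+-assoc M (k * M) r) ⟩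
        count inClass? (M + (k * M + r))                              ≡⟨ count-shift inClass? M (k * M + r) ⟩
        c + count (λ n → inClass? (M + n)) (k * M + r)                 ≡⟨ cong (c +_) (count-shift-period (k * M + r)) ⟩
        c + count inClass? (k * M + r)                                ≡⟨ cong (c +_) (count-blocks k r) ⟩
        c + (k * c + count inClass? r)                                ≡⟨ +-assoc c (k * c) _ ⟨
        suc k * c + count inClass? r                                  ∎
        where open ≡-Reasoning

      blocks-identity₁ : ∀ k c s M → (k * c + s) * M ≡ c * (k * M) + s * M
      blocks-identity₁ = solve-∀

      blocks-identity₂ : ∀ c k M r → c * (k * M + r) ≡ c * (k * M) + c * r
      blocks-identity₂ = solve-∀

      count-residues-blocks : ∀ k r → r ≤ M → let L = k * M + r in
        count inClass? L * M ≤ c * L + M * M × c * L ≤ count inClass? L * M + M * M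
      count-residues-blocks k r r≤M rewrite count-blocks k r | blocks-identity₁ k c (count inClass? r) M | blocks-identity₂ c k M r =
          ≤-trans (+-monoʳ-≤ (c * (k * M)) (≤-trans (*-monoˡ-≤ M s≤M) (m≤n+m (M * M) (c * r))))
                  (≤-reflexive (sym (+-assoc (c * (k * M)) (c * r) (M * M))))
        , ≤-trans (+-monoʳ-≤ (c * (k * M)) (≤-trans (*-mono-≤ (count≤ inClass? M) r≤M) (m≤n+m (M * M) (s * M))))
                  (≤-reflexive (sym (+-assoc (c * (k * M)) (s * M) (M * M))))
        where
        s = count inClass? r
        s≤M : s ≤ M
        s≤M = ≤-trans (count≤ inClass? r) r≤M

    count-residues : ∀ L → count inClass? L * M ≤ c * L + M * M × c * L ≤ count inClass? L * M + M * M
    count-residues L = subst (λ L → count inClass? L * M ≤ c * L + M * M × c * L ≤ count inClass? L * M + M * M)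
      (sym L≡kM+r) (count-residues-blocks (L / M) (L % M) (m%n≤n L M))
      where
      L≡kM+r : L ≡ L / M * M + L % M
      L≡kM+r = trans (m≡m%n+[m/n]*n L M) (+-comm (L % M) _)

  ∑< : ℕ → (ℕ → ℕ) → ℕ
  ∑< zero    f = 0
  ∑< (suc v) f = ∑< v f + f v

  syntax ∑< v (λ i → e) = ∑[ i < v ] e

  ∑<-mono : ∀ v {f g : ℕ → ℕ} → (∀ {i} → i < v → f i ≤ g i) → ∑[ i < v ] f i ≤ ∑[ i < v ] g i
  ∑<-mono zero    f≤g = z≤n
  ∑<-mono (suc v) f≤g = +-mono-≤ (∑<-mono v (λ i<v → f≤g (m<n⇒m<1+n i<v))) (f≤g ≤-refl)

  ∑<-≤-* : ∀ v {f : ℕ → ℕ} {b} → (∀ {i} → i < v → f i ≤ b) → ∑[ i < v ] f i ≤ v * b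
  ∑<-≤-* zero    f≤b = z≤n
  ∑<-≤-* (suc v) {b = b} f≤b = ≤-trans (+-mono-≤ (∑<-≤-* v (λ i<v → f≤b (m<n⇒m<1+n i<v))) (f≤b ≤-refl))
                                        (≤-reflexive (+-comm (v * b) b))

  ∃<? : {Q : ℕ → Pred ℕ 0ℓ} → (∀ i → Decidable (Q i)) → ∀ v → Decidable (λ n → ∃[ i ] i < v × Q i n)
  ∃<? Q? v n = anyUpTo? (λ i → Q? i n) v

  count-∃< : {Q : ℕ → Pred ℕ 0ℓ} (Q? : ∀ i → Decidable (Q i)) → ∀ v L →
             count (∃<? Q? v) L ≤ ∑[ i < v ] count (Q? i) L
  count-∃< Q? zero    L = ≤-reflexive (count-∅ (∃<? Q? 0) (λ ()) L)
  count-∃< Q? (suc v) L = ≤-trans (count-cover (∃<? Q? (suc v)) (∃<? Q? v) (Q? v) split)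
                                   (+-monoˡ-≤ (count (Q? v) L) (count-∃< Q? v L))
    where
    split : (λ n → ∃[ i ] i < suc v × _) ⊆[1, L ] ((λ n → ∃[ i ] i < v × _) ∪ _)
    split _ _ (i , i<1+v , Qin) with m<1+n⇒m<n∨m≡n i<1+v
    ... | inj₁ i<v  = inj₁ (i , i<v , Qin)
    ... | inj₂ refl = inj₂ Qin

  *≤⇒≤/ : ∀ {m n o} .{{_ : NonZero n}} → m * n ≤ o → m ≤ o / n
  *≤⇒≤/ {m} {n} mn≤o = subst (_≤ _ / n) (m*n/n≡m m n) (/-monoˡ-≤ n mn≤o)

  m<[1+m/n]*n : ∀ m n .{{_ : NonZero n}} → m < suc (m / n) * n
  m<[1+m/n]*n m n = subst (_< suc (m / n) * n) (sym (m≡m%n+[m/n]*n m n)) (+-monoˡ-< (m / n * n) (m%n<n m n))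

  count-∣ : ∀ d .{{_ : NonZero d}} L → count (d ∣?_) L ≡ L / d
  count-∣ d L = ≤-antisym (*≤⇒≤/ (proj₁ (bounds L))) (s≤s⁻¹ (m<n*o⇒m/o<n (proj₂ (bounds L))))
    where
    bounds : ∀ L → count (d ∣?_) L * d ≤ L × L < suc (count (d ∣?_) L) * d
    bounds zero    = z≤n , subst (0 <_) (sym (*-identityˡ d)) (>-nonZero⁻¹ d)
    bounds (suc L) with bounds L | d ∣? suc L
    ... | qd≤L , L<[1+q]d | no d∤1+L =
      subst (_≤ suc L) (sym (cong (_* d) (+-identityʳ (count (d ∣?_) L)))) (m≤n⇒m≤1+n qd≤L) ,
      subst (λ c → suc L < suc c * d) (sym (+-identityʳ (count (d ∣?_) L)))
            (≤∧≢⇒< L<[1+q]d λ 1+L≡[1+q]d → d∤1+L (divides (suc (count (d ∣?_) L)) 1+L≡[1+q]d))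
    ... | qd≤L , L<[1+q]d | yes (divides k 1+L≡kd) =
      subst (_≤ suc L) (cong (_* d) (+-comm 1 (count (d ∣?_) L))) (≤-trans (*-monoˡ-≤ d q<k) (≤-reflexive (sym 1+L≡kd))) ,
      subst (λ c → suc L < suc c * d) (+-comm 1 (count (d ∣?_) L)) (≤-<-trans L<[1+q]d (m<n+m _ (>-nonZero⁻¹ d)))
      where
      q<k : count (d ∣?_) L < k
      q<k = *-cancelʳ-< d _ k (≤-<-trans qd≤L (subst (L <_) 1+L≡kd ≤-refl))

  count-∃<-∣ : (e : ℕ → ℕ) .{{_ : ∀ {i} → NonZero (e i)}} → ∀ v L →
               count (∃<? (λ i → e i ∣?_) v) L ≤ ∑[ i < v ] (L / e i)
  count-∃<-∣ e v L = ≤-trans (count-∃< (λ i → e i ∣?_) v L) (∑<-mono v λ {i} _ → ≤-reflexive (count-∣ (e i) L))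

  -- ∑_{d ≥ p + 2} X / d² ≤ X / (p + 1): it telescopes, as X / (e + 1)² + X / (e + 1) ≤ X / e
  ∑</square≤ : ∀ X p v → ∑[ i < v ] (X / (suc (suc p + i) * suc (suc p + i))) ≤ X / suc p
  ∑</square≤ X p v = ≤-trans (m≤m+n _ _) (telescope v)
    where
    square : ℕ → ℕ
    square i = suc (suc p + i) * suc (suc p + i)

    step : ∀ e .{{_ : NonZero e}} → X / (suc e * suc e) + X / suc e ≤ X / e
    step e = subst (_≤ X / e) (+-comm a b) (*≤⇒≤/ (begin
      (a + b) * e    ≡⟨ *-distribʳ-+ e a b ⟩
      a * e + b * e  ≤⟨ +-monoʳ-≤ (a * e) (≤-trans (*-monoʳ-≤ b (n≤1+n e)) bd≤a) ⟩
      a * e + a      ≡⟨ trans (+-comm (a * e) a) (sym (*-suc a e)) ⟩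
      a * suc e      ≤⟨ m/n*n≤m X (suc e) ⟩
      X              ∎))
      where
      open ≤-Reasoning
      a = X / suc e
      b = X / (suc e * suc e)
      bd≤a : b * suc e ≤ a
      bd≤a = *≤⇒≤/ (subst (_≤ X) (sym (*-assoc b (suc e) (suc e))) (m/n*n≤m X (suc e * suc e)))

    telescope : ∀ v → ∑[ i < v ] (X / square i) + X / suc (p + v) ≤ X / suc p
    telescope zero    = ≤-reflexive (cong (λ n → X / suc n) (+-identityʳ p))
    telescope (suc v) = begin
      ∑[ i < v ] (X / square i) + X / square v + X / suc (p + suc v)   ≡⟨ +-assoc (∑[ i < v ] (X / square i)) _ _ ⟩
      ∑[ i < v ] (X / square i) + (X / square v + X / suc (p + suc v))
        ≡⟨ cong (λ n → ∑[ i < v ] (X / square i) + (X / square v + X / suc n)) (+-suc p v) ⟩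
      ∑[ i < v ] (X / square i) + (X / square v + X / suc (suc p + v)) ≤⟨ +-monoʳ-≤ (∑[ i < v ] (X / square i)) (step (suc (p + v))) ⟩
      ∑[ i < v ] (X / square i) + X / suc (p + v)                      ≤⟨ telescope v ⟩
      X / suc p                                                      ∎
      where open ≤-Reasoning

module Valuations where

  open import Data.Nat
  open import Data.Nat.Properties
  open import Data.Nat.Divisibility
  open import Data.Nat.Primality
  open import Data.List using ([]; _∷_; map; upTo)
  open import Data.List.Membership.Propositional using (_∈_)
  open import Data.List.Membership.Propositional.Properties using (∈-upTo⁺; ∈-map⁻; foldr-selective)
  open import Data.List.Relation.Unary.Any using (here; there)
  open import Data.Bool using (if_then_else_)
  open import Data.Empty using (⊥-elim)
  open import Data.Product using (_×_; _,_; ∃-syntax)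
  open import Data.Sum using (_⊎_; inj₁; inj₂)
  open import Relation.Nullary using (yes; no; does; ¬_)
  open import Data.Nat.DivMod using (_%_)
  open import Function using (_∘_)
  open import Relation.Binary.PropositionalEquality

  ≤maximum : ∀ (f : ℕ → ℕ) {xs a} → a ∈ xs → f a ≤ maximum (map f xs)
  ≤maximum f {x ∷ xs} (here refl) = m≤m⊔n (f x) _
  ≤maximum f {x ∷ xs} (there a∈) = ≤-trans (≤maximum f a∈) (m≤n⊔m (f x) _)

  maximum≤ : ∀ (f : ℕ → ℕ) xs {b} → (∀ {a} → a ∈ xs → f a ≤ b) → maximum (map f xs) ≤ b
  maximum≤ f []       fxs≤b = z≤n
  maximum≤ f (x ∷ xs) fxs≤b = ⊔-lub (fxs≤b (here refl)) (maximum≤ f xs (fxs≤b ∘ there))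

  maximum-attained : ∀ (f : ℕ → ℕ) xs → maximum (map f xs) ≡ 0 ⊎ ∃[ a ] a ∈ xs × maximum (map f xs) ≡ f a
  maximum-attained f xs with foldr-selective ⊔-sel 0 (map f xs)
  ... | inj₁ max≡0 = inj₁ max≡0
  ... | inj₂ max∈  = inj₂ (∈-map⁻ f max∈)

  maximum-cong : ∀ {f g : ℕ → ℕ} xs → (∀ {a} → a ∈ xs → f a ≡ g a) → maximum (map f xs) ≡ maximum (map g xs)
  maximum-cong []       f≡g = refl
  maximum-cong (x ∷ xs) f≡g = cong₂ _⊔_ (f≡g (here refl)) (maximum-cong xs (λ a∈ → f≡g (there a∈)))

  n<2^n : ∀ n → n < 2 ^ n
  n<2^n zero    = s≤s z≤n
  n<2^n (suc n) = +-mono-<-≤ (m^n>0 2 n) (≤-trans (n<2^n n) (≤-reflexive (sym (+-identityʳ (2 ^ n)))))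

  n<p^n : ∀ {p} n → 2 ≤ p → n < p ^ n
  n<p^n n 2≤p = <-≤-trans (n<2^n n) (^-monoˡ-≤ n 2≤p)

  p^m∣p^n : ∀ p {m n} → m ≤ n → p ^ m ∣ p ^ n
  p^m∣p^n p {m} {n} m≤n = divides (p ^ (n ∸ m)) (trans (cong (p ^_) (sym (m∸n+n≡m m≤n))) (^-distribˡ-+-* p (n ∸ m) m))

  prime⇒≥2 : ∀ {p} → Prime p → 2 ≤ p
  prime⇒≥2 {p} pr = nonTrivial⇒n>1 p {{prime⇒nonTrivial pr}}

  p^val∣n : ∀ p n → p ^ val p n ∣ n
  p^val∣n p n with maximum-attained (λ a → if does (p ^ a ∣? n) then a else 0) (upTo (suc n))
  ... | inj₁ val≡0 = subst (λ v → p ^ v ∣ n) (sym val≡0) (1∣ n)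
  ... | inj₂ (a , _ , val≡) = subst (λ v → p ^ v ∣ n) (sym val≡) (attained a)
    where
    attained : ∀ a → p ^ (if does (p ^ a ∣? n) then a else 0) ∣ n
    attained a with p ^ a ∣? n
    ... | yes p^a∣n = p^a∣n
    ... | no  _     = 1∣ n

  p^k∣n⇒k≤val : ∀ {p n k} → 2 ≤ p → 0 < n → p ^ k ∣ n → k ≤ val p n
  p^k∣n⇒k≤val {p} {n} {k} 2≤p 0<n p^k∣n =
    subst (_≤ val p n) taken (≤maximum (λ a → if does (p ^ a ∣? n) then a else 0) (∈-upTo⁺ k<1+n))
    where
    k<1+n : k < suc n
    k<1+n = s≤s (<⇒≤ (<-≤-trans (n<p^n k 2≤p) (∣⇒≤ {{>-nonZero 0<n}} p^k∣n)))
    taken : (if does (p ^ k ∣? n) then k else 0) ≡ k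
    taken with p ^ k ∣? n
    ... | yes _ = refl
    ... | no ¬p^k∣n = ⊥-elim (¬p^k∣n p^k∣n)

  k≤val⇒p^k∣n : ∀ {p n k} → k ≤ val p n → p ^ k ∣ n
  k≤val⇒p^k∣n {p} {n} k≤val = ∣-trans (p^m∣p^n p k≤val) (p^val∣n p n)

  p^[1+c]∤n⇒val≤c : ∀ {p n c} → ¬ p ^ suc c ∣ n → val p n ≤ c
  p^[1+c]∤n⇒val≤c p^[1+c]∤n = ≮⇒≥ (λ c<val → p^[1+c]∤n (k≤val⇒p^k∣n c<val))

  val<n : ∀ {p n} → 2 ≤ p → 0 < n → val p n < n
  val<n {p} {n} 2≤p 0<n = <-≤-trans (n<p^n (val p n) 2≤p) (∣⇒≤ {{>-nonZero 0<n}} (p^val∣n p n))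

  val-p^ : ∀ {p} a → 2 ≤ p → val p (p ^ a) ≡ a
  val-p^ {p} a 2≤p = ≤-antisym
    (≮⇒≥ λ a<val → <⇒≱ (^-monoʳ-< p 2≤p a<val) (∣⇒≤ {{p^a≢0}} (p^val∣n p (p ^ a))))
    (p^k∣n⇒k≤val 2≤p (>-nonZero⁻¹ _ {{p^a≢0}}) ∣-refl)
    where
    p^a≢0 = m^n≢0 p a {{>-nonZero (<-trans (s≤s z≤n) 2≤p)}}

  val-% : ∀ {p n c M} .{{_ : NonZero M}} → 2 ≤ p → 0 < n → p ^ suc c ∣ M → ¬ p ^ suc c ∣ n →
          val p (n % M) ≡ val p n
  val-% {p} {n} {c} {M} 2≤p 0<n p^[1+c]∣M p^[1+c]∤n = ≤-antisym
    (p^k∣n⇒k≤val 2≤p 0<n (∣n∣m%n⇒∣m (p^e∣M val[n%M]≤c) (p^val∣n p (n % M))))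
    (p^k∣n⇒k≤val 2≤p 0<n%M (%-presˡ-∣ (p^val∣n p n) (p^e∣M (p^[1+c]∤n⇒val≤c p^[1+c]∤n))))
    where
    p^e∣M : ∀ {e} → e ≤ c → p ^ e ∣ M
    p^e∣M e≤c = ∣-trans (p^m∣p^n p (m≤n⇒m≤1+n e≤c)) p^[1+c]∣M
    0<n%M : 0 < n % M
    0<n%M = n≢0⇒n>0 λ n%M≡0 → p^[1+c]∤n (∣-trans p^[1+c]∣M (m%n≡0⇒n∣m n M n%M≡0))
    val[n%M]≤c : val p (n % M) ≤ c
    val[n%M]≤c = p^[1+c]∤n⇒val≤c λ p^[1+c]∣n%M → p^[1+c]∤n (∣n∣m%n⇒∣m p^[1+c]∣M p^[1+c]∣n%M)

module Height where

  open Valuations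
  open import Data.Nat
  open import Data.Nat.Properties
  open import Data.Nat.Divisibility
  open import Data.Nat.Primality
  open import Data.List using (map; upTo)
  open import Data.List.Membership.Propositional using (_∈_)
  open import Data.List.Membership.Propositional.Properties using (∈-upTo⁺; ∈-filter⁺; ∈-filter⁻)
  open import Data.Empty using (⊥-elim)
  open import Data.Product using (_×_; _,_; ∃-syntax; proj₂)
  open import Data.Sum using (_⊎_; inj₁; inj₂)
  open import Relation.Nullary using (yes; no; _×-dec_)
  open import Relation.Binary.PropositionalEquality
  open import Function using (_∘_)

  ∈primeDivisors⁻ : ∀ {n p} → p ∈ primeDivisors n → Prime p × p ∣ n
  ∈primeDivisors⁻ {n} p∈ = proj₂ (∈-filter⁻ (λ p → prime? p ×-dec p ∣? n) {xs = upTo (suc n)} p∈)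

  ∈primeDivisors⁺ : ∀ {n p} → 0 < n → Prime p → p ∣ n → p ∈ primeDivisors n
  ∈primeDivisors⁺ {n} 0<n pr p∣n =
    ∈-filter⁺ (λ p → prime? p ×-dec p ∣? n) (∈-upTo⁺ (s≤s (∣⇒≤ {{>-nonZero 0<n}} p∣n))) (pr , p∣n)

  private
    val<n-primeDivisor : ∀ {n p} → 0 < n → p ∈ primeDivisors n → val p n < n
    val<n-primeDivisor {n} 0<n p∈ with ∈primeDivisors⁻ {n} p∈
    ... | pr , _ = val<n (prime⇒≥2 pr) 0<n

  heightF-fuel : ∀ f g {n} → n ≤ f → n ≤ g → heightF f n ≡ heightF g n
  heightF-fuel zero    zero    _   _   = refl
  heightF-fuel zero    (suc g) z≤n _   = refl
  heightF-fuel (suc f) zero    _   z≤n = refl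
  heightF-fuel (suc f) (suc g) {0}           _   _   = refl
  heightF-fuel (suc f) (suc g) {1}           _   _   = refl
  heightF-fuel (suc f) (suc g) {n@(2+ _)} n≤1+f n≤1+g = cong suc (maximum-cong (primeDivisors n) λ {p} p∈ →
    let v<n = val<n-primeDivisor {n} {p} (s≤s z≤n) p∈ in
    heightF-fuel f g (s≤s⁻¹ (<-≤-trans v<n n≤1+f)) (s≤s⁻¹ (<-≤-trans v<n n≤1+g)))

  H≡0 : ∀ {n} → n ≤ 1 → H n ≡ 0
  H≡0 {0} _ = refl
  H≡0 {1} _ = refl
  H≡0 {2+ _} (s≤s ())

  H-recurrence : ∀ {n} → 2 ≤ n → H n ≡ suc (maximum (map (λ p → H (val p n)) (primeDivisors n)))
  H-recurrence {n@(2+ m)} _ = cong suc (maximum-cong (primeDivisors n) λ {p} p∈ →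
    heightF-fuel (suc m) (val p n) (s≤s⁻¹ (val<n-primeDivisor {n} (s≤s z≤n) p∈)) ≤-refl)
  H-recurrence {1} (s≤s ())

  ≤H-val⇒suc≤H : ∀ {n p j} → 0 < n → Prime p → 0 < j → j ≤ H (val p n) → suc j ≤ H n
  ≤H-val⇒suc≤H {n} {p} {j} 0<n pr 0<j j≤H[val] =
    subst (suc j ≤_) (sym (H-recurrence 2≤n))
      (s≤s (≤-trans j≤H[val] (≤maximum (λ q → H (val q n)) (∈primeDivisors⁺ 0<n pr p∣n))))
    where
    p∣n : p ∣ n
    p∣n = subst (_∣ n) (*-identityʳ p)
            (k≤val⇒p^k∣n (n≢0⇒n>0 λ val≡0 → <⇒≱ 0<j (subst (λ v → j ≤ H v) val≡0 j≤H[val])))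
    2≤n : 2 ≤ n
    2≤n = ≤-trans (prime⇒≥2 pr) (∣⇒≤ {{>-nonZero 0<n}} p∣n)

  suc≤H⇒≤H-val : ∀ {n j} → 0 < j → suc j ≤ H n → ∃[ p ] Prime p × p ∣ n × j ≤ H (val p n)
  suc≤H⇒≤H-val {n} {j} 0<j 1+j≤H with n ≤? 1
  ... | yes n≤1 = ⊥-elim (<⇒≱ (s≤s z≤n) (subst (suc j ≤_) (H≡0 n≤1) 1+j≤H))
  ... | no  n≰1 with maximum-attained (λ q → H (val q n)) (primeDivisors n)
  ...   | inj₁ max≡0 = ⊥-elim (<⇒≱ (s≤s 0<j) (subst (suc j ≤_) (trans (H-recurrence (≰⇒> n≰1)) (cong suc max≡0)) 1+j≤H))
  ...   | inj₂ (p , p∈ , max≡) with ∈primeDivisors⁻ {n} p∈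
  ...     | pr , p∣n = p , pr , p∣n , s≤s⁻¹ (subst (suc j ≤_) (trans (H-recurrence (≰⇒> n≰1)) (cong suc max≡)) 1+j≤H)

  H-val≤⇒H≤suc : ∀ {n j} → (∀ {p} → Prime p → p ∣ n → H (val p n) ≤ j) → H n ≤ suc j
  H-val≤⇒H≤suc {n} {j} H[val]≤j with n ≤? 1
  ... | yes n≤1 = subst (_≤ suc j) (sym (H≡0 n≤1)) z≤n
  ... | no  n≰1 = subst (_≤ suc j) (sym (H-recurrence (≰⇒> n≰1)))
                    (s≤s (maximum≤ (λ q → H (val q n)) (primeDivisors n) λ p∈ →
                      let pr , p∣n = ∈primeDivisors⁻ {n} p∈ in H[val]≤j pr p∣n))

  0<H⇒2≤ : ∀ {a} → 0 < H a → 2 ≤ a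
  0<H⇒2≤ {a} 0<H = ≰⇒> λ a≤1 → <⇒≱ 0<H (≤-reflexive (H≡0 a≤1))

  0<k≤H⇒0< : ∀ {k a} → 0 < k → k ≤ H a → 0 < a
  0<k≤H⇒0< 0<k k≤H = <-trans (s≤s z≤n) (0<H⇒2≤ (<-≤-trans 0<k k≤H))

  2↑↑k≤ : ∀ {k a} → 0 < k → k ≤ H a → 2 ↑↑ k ≤ a
  2↑↑k≤ {1}      {a} _ 1≤H   = 0<H⇒2≤ 1≤H
  2↑↑k≤ {2+ k}   {a} _ 2+k≤H =
    let p , pr , _ , 1+k≤H[val] = suc≤H⇒≤H-val {a} (s≤s z≤n) 2+k≤H in
    ≤-trans (^-monoˡ-≤ (2 ↑↑ suc k) (prime⇒≥2 pr))
            (∣⇒≤ {{>-nonZero (0<k≤H⇒0< (s≤s z≤n) 2+k≤H)}} (k≤val⇒p^k∣n (2↑↑k≤ {suc k} {val p a} (s≤s z≤n) 1+k≤H[val])))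

  2≤2↑↑ : ∀ {k} → 0 < k → 2 ≤ 2 ↑↑ k
  2≤2↑↑ {suc k} _ = ^-monoʳ-≤ 2 {1} (>-nonZero⁻¹ (2 ↑↑ k) {{2↑↑-nonZero k}})

  2*2^n≤3^n : ∀ {n} → 2 ≤ n → 2 * 2 ^ n ≤ 3 ^ n
  2*2^n≤3^n {1}    (s≤s ())
  2*2^n≤3^n {2}    _ = s≤s (s≤s (s≤s (s≤s (s≤s (s≤s (s≤s (s≤s z≤n)))))))
  2*2^n≤3^n {suc (2+ n)} _ = *-mono-≤ {2} {3} (s≤s (s≤s z≤n)) (2*2^n≤3^n {2+ n} (s≤s (s≤s z≤n)))

  a≡2↑↑k⊎2*2↑↑k≤a : ∀ {k a} → 2 ≤ k → k ≤ H a → a ≡ 2 ↑↑ k ⊎ 2 * 2 ↑↑ k ≤ a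
  a≡2↑↑k⊎2*2↑↑k≤a {suc j} {a} (s≤s 0<j) 1+j≤H with suc≤H⇒≤H-val {a} 0<j 1+j≤H
  ... | p , pr , _ , j≤H[val] with p ≟ 2 | k≤val⇒p^k∣n {p} {a} (2↑↑k≤ 0<j j≤H[val])
  ...   | no p≢2 | p^T∣a = inj₂ (≤-trans (2*2^n≤3^n (2≤2↑↑ 0<j))
                             (≤-trans (^-monoˡ-≤ (2 ↑↑ j) 3≤p) (∣⇒≤ {{>-nonZero (0<k≤H⇒0< (s≤s z≤n) 1+j≤H)}} p^T∣a)))
    where
    3≤p : 3 ≤ p
    3≤p = ≤∧≢⇒< (prime⇒≥2 pr) (p≢2 ∘ sym)
  ...   | yes refl | divides 0             a≡0     = ⊥-elim (<⇒≢ (0<k≤H⇒0< (s≤s z≤n) 1+j≤H) (sym a≡0))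
  ...   | yes refl | divides 1             a≡2^T   = inj₁ (trans a≡2^T (+-identityʳ _))
  ...   | yes refl | divides (2+ q)        a≡q2^T  = inj₂ (subst (2 * 2 ↑↑ suc j ≤_) (sym a≡q2^T)
                                                            (*-monoˡ-≤ (2 ↑↑ suc j) {2} {2+ q} (s≤s (s≤s z≤n))))

  prime∣2^n⇒≡2 : ∀ {p} n → Prime p → p ∣ 2 ^ n → p ≡ 2
  prime∣2^n⇒≡2 zero    pr p∣1 = ⊥-elim (¬prime[1] (subst Prime (∣1⇒≡1 p∣1) pr))
  prime∣2^n⇒≡2 (suc n) pr p∣2^[1+n] with euclidsLemma 2 (2 ^ n) pr p∣2^[1+n]
  ... | inj₁ p∣2   = ≤-antisym (∣⇒≤ p∣2) (prime⇒≥2 pr)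
  ... | inj₂ p∣2^n = prime∣2^n⇒≡2 n pr p∣2^n

  H-2^ : ∀ {a} → 0 < H a → H (2 ^ a) ≡ suc (H a)
  H-2^ {a} 0<H[a] = ≤-antisym
    (H-val≤⇒H≤suc λ {p} pr p∣2^a → subst (λ q → H (val q (2 ^ a)) ≤ H a) (sym (prime∣2^n⇒≡2 a pr p∣2^a))
                                         (≤-reflexive H[val]≡H[a]))
    (≤H-val⇒suc≤H (m^n>0 2 a) prime[2] 0<H[a] (≤-reflexive (sym H[val]≡H[a])))
    where
    H[val]≡H[a] : H (val 2 (2 ^ a)) ≡ H a
    H[val]≡H[a] = cong H (val-p^ a ≤-refl)

  H-2↑↑ : ∀ {k} → 0 < k → H (2 ↑↑ k) ≡ k
  H-2↑↑ {1}    _ = refl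
  H-2↑↑ {2+ k} _ = let H[2↑↑[1+k]]≡1+k = H-2↑↑ {suc k} (s≤s z≤n) in
    trans (H-2^ {2 ↑↑ suc k} (subst (0 <_) (sym H[2↑↑[1+k]]≡1+k) (s≤s z≤n))) (cong suc H[2↑↑[1+k]]≡1+k)

module Existence where

  open Counting
  open Fractions using (Within; /≤/+1/)
  open import Data.Integer using (+_)
  import Data.Rational as ℚ
  open Valuations
  open Height
  open import Data.Nat
  open import Data.Nat.Properties
  open import Data.Nat.Divisibility
  open import Data.Nat.DivMod
  open import Data.Nat.Primality
  open import Data.Nat.Tactic.RingSolver using (solve-∀)
  open import Data.Empty using (⊥-elim)
  open import Data.Product using (_×_; _,_; ∃-syntax; proj₁; proj₂)
  open import Data.Sum using (_⊎_; inj₁; inj₂)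
  open import Function using (_∘_; id; _⇔_; mk⇔; Equivalence)
  import Data.Sum
  open import Level using (0ℓ)
  open import Relation.Binary.PropositionalEquality
  open import Relation.Nullary using (yes; no; ¬_; ¬?; _×-dec_)
  open import Relation.Unary using (Pred; Decidable)
  open import Relation.Unary.Properties using (_∪?_)
  open Equivalence using (to; from)

  powerProduct : ℕ → ℕ → ℕ
  powerProduct zero    C = 1
  powerProduct (suc P) C = powerProduct P C * suc P ^ suc C

  powerProduct-nonZero : ∀ P C → NonZero (powerProduct P C)
  powerProduct-nonZero zero    C = _
  powerProduct-nonZero (suc P) C = m*n≢0 _ _ {{powerProduct-nonZero P C}} {{m^n≢0 (suc P) (suc C)}}

  d^[1+C]∣powerProduct : ∀ {P C d} → 0 < d → d ≤ P → d ^ suc C ∣ powerProduct P C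
  d^[1+C]∣powerProduct {zero}  0<d d≤0 = ⊥-elim (<⇒≱ 0<d d≤0)
  d^[1+C]∣powerProduct {suc P} {C} {d} 0<d d≤1+P with m≤n⇒m<n∨m≡n d≤1+P
  ... | inj₁ d<1+P = ∣-trans (d^[1+C]∣powerProduct 0<d (s≤s⁻¹ d<1+P)) (m∣m*n _)
  ... | inj₂ refl  = n∣m*n (powerProduct P C)

  module Truncation (k p C : ℕ) where

    P M : ℕ
    P = suc p
    M = powerProduct P C

    instance
      M≢0 : NonZero M
      M≢0 = powerProduct-nonZero P C
      2^[1+C]≢0 : NonZero (2 ^ suc C)
      2^[1+C]≢0 = m^n≢0 2 (suc C)

    Witnessed : ℕ → Pred ℕ 0ℓ
    Witnessed j r = ∃[ q ] q < suc P × (Prime q × j ≤ H (val q r))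

    witnessed? : ∀ j → Decidable (Witnessed j)
    witnessed? j r = anyUpTo? (λ q → prime? q ×-dec j ≤? H (val q r)) (suc P)

    -- for such n, v_q(n) = v_q(n % M) if q ≤ P, and v_q(n) ≤ 1 if q > P
    Tame : Pred ℕ 0ℓ
    Tame n = (∀ {q} → Prime q → q ≤ P → ¬ q ^ suc C ∣ n) × (∀ {d} → P < d → ¬ d * d ∣ n)

    suc≤H⇔Witnessed : ∀ {j n} → 0 < j → 0 < n → Tame n → suc j ≤ H n ⇔ Witnessed j (n % M)
    suc≤H⇔Witnessed {j} {n} 0<j 0<n (tame-small , tame-large) = mk⇔ witness height
      where
      val-mod : ∀ {q} → Prime q → q ≤ P → val q (n % M) ≡ val q n
      val-mod {q} pr q≤P = val-% {q} {n} {C} (prime⇒≥2 pr) 0<n (d^[1+C]∣powerProduct (<-trans (s≤s z≤n) (prime⇒≥2 pr)) q≤P)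
                             (tame-small pr q≤P)

      witness : suc j ≤ H n → Witnessed j (n % M)
      witness 1+j≤H with suc≤H⇒≤H-val {n} 0<j 1+j≤H
      ... | q , pr , _ , j≤H[val] with q ≤? P
      ...   | yes q≤P = q , s≤s q≤P , pr , subst (λ v → j ≤ H v) (sym (val-mod pr q≤P)) j≤H[val]
      ...   | no  q≰P = ⊥-elim (<⇒≱ 0<j (subst (j ≤_) (H≡0 val≤1) j≤H[val]))
        where
        val≤1 : val q n ≤ 1
        val≤1 = p^[1+c]∤n⇒val≤c (tame-large (≰⇒> q≰P) ∘ subst (_∣ n) (cong (q *_) (*-identityʳ q)))

      height : Witnessed j (n % M) → suc j ≤ H n
      height (q , q<1+P , pr , j≤H[val]) =
        ≤H-val⇒suc≤H 0<n pr 0<j (subst (λ v → j ≤ H v) (val-mod pr (s≤s⁻¹ q<1+P)) j≤H[val])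

    Truncated : Pred ℕ 0ℓ
    Truncated r = Witnessed k r × ¬ Witnessed (suc k) r

    truncated? : Decidable Truncated
    truncated? r = witnessed? k r ×-dec ¬? (witnessed? (suc k) r)

    open Residues truncated? M public

    H≡1+k⇔Truncated : ∀ {n} → 0 < k → 0 < n → Tame n → H n ≡ suc k ⇔ Truncated (n % M)
    H≡1+k⇔Truncated {n} 0<k 0<n tame = mk⇔
      (λ H≡1+k → to (atLeast k 0<k) (≤-reflexive (sym H≡1+k)) ,
                 λ w → <⇒≢ (from (atLeast (suc k) (s≤s z≤n)) w) (sym H≡1+k))
      (λ (w , ¬w′) → ≤-antisym (≮⇒≥ (¬w′ ∘ to (atLeast (suc k) (s≤s z≤n)))) (from (atLeast k 0<k) w))
      where
      atLeast : ∀ j → 0 < j → suc j ≤ H n ⇔ Witnessed j (n % M)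
      atLeast j 0<j = suc≤H⇔Witnessed 0<j 0<n tame

    Exceptional : ℕ → Pred ℕ 0ℓ
    Exceptional L n = (∃[ i ] i < p × (2 + i) ^ suc C ∣ n) ⊎ (∃[ i ] i < L × suc (P + i) * suc (P + i) ∣ n)

    exceptional? : ∀ L → Decidable (Exceptional L)
    exceptional? L = ∃<? (λ i → (2 + i) ^ suc C ∣?_) p ∪? ∃<? (λ i → suc (P + i) * suc (P + i) ∣?_) L

    tame⊎exceptional : ∀ {L n} → 0 < n → n ≤ L → Tame n ⊎ Exceptional L n
    tame⊎exceptional {L} {n} 0<n n≤L with exceptional? L n
    ... | yes e = inj₂ e
    ... | no ¬e = inj₁ (small , large)
      where
      small : ∀ {q} → Prime q → q ≤ P → ¬ q ^ suc C ∣ n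
      small {q} pr q≤P q^[1+C]∣n = ¬e (inj₁ (q ∸ 2 , ∸-monoˡ-< (s≤s q≤P) 2≤q ,
        subst (λ d → d ^ suc C ∣ n) (sym (m+[n∸m]≡n 2≤q)) q^[1+C]∣n))
        where 2≤q = prime⇒≥2 pr
      large : ∀ {d} → P < d → ¬ d * d ∣ n
      large {d} P<d d²∣n = ¬e (inj₂ (d ∸ suc P , ≤-trans (∸-monoˡ-< d<1+L P<d) (m∸n≤m L P) ,
        subst (λ d → d * d ∣ n) (sym (m+[n∸m]≡n P<d)) d²∣n))
        where
        d<1+L : d < suc L
        d<1+L = s≤s (≤-trans (∣⇒≤ {{>-nonZero 0<n}} (∣-trans (m∣m*n d) d²∣n)) n≤L)

    count-exceptional : ∀ L → count (exceptional? L) L ≤ p * (L / 2 ^ suc C) + L / P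
    count-exceptional L = ≤-trans (count-∪ _ _ L) (+-mono-≤
      (≤-trans (count-∃<-∣ (λ i → (2 + i) ^ suc C) {{λ {i} → m^n≢0 (2 + i) (suc C)}} p L)
               (∑<-≤-* p λ {i} _ → /-monoʳ-≤ L {{m^n≢0 (2 + i) (suc C)}} (^-monoˡ-≤ (suc C) (m≤m+n 2 i))))
      (≤-trans (count-∃<-∣ (λ i → suc (P + i) * suc (P + i)) L L) (∑</square≤ L p L)))

    height? : Decidable (λ n → H n ≡ suc k)
    height? n = H n ≟ suc k

    count-height≤inClass+exceptional : 0 < k → ∀ L → count height? L ≤ count inClass? L + count (exceptional? L) L
    count-height≤inClass+exceptional 0<k L = count-cover height? inClass? (exceptional? L) λ 0<n n≤L H≡1+k →
      Data.Sum.map (λ tame → to (H≡1+k⇔Truncated 0<k 0<n tame) H≡1+k) id (tame⊎exceptional 0<n n≤L)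

    count-inClass≤height+exceptional : 0 < k → ∀ L → count inClass? L ≤ count height? L + count (exceptional? L) L
    count-inClass≤height+exceptional 0<k L = count-cover inClass? height? (exceptional? L) λ 0<n n≤L truncated →
      Data.Sum.map (λ tame → from (H≡1+k⇔Truncated 0<k 0<n tame) truncated) id (tame⊎exceptional 0<n n≤L)

  countH≡count : ∀ m L → countH m L ≡ count (λ n → H n ≟ m) L
  countH≡count m zero    = refl
  countH≡count m (suc L) = cong (_+ 𝟙 (H (suc L) ≟ m)) (countH≡count m L)

  private
    halves : ∀ {a b Q L} → a * (2 * Q) ≤ L → b * (2 * Q) ≤ L → (a + b) * Q ≤ L
    halves {a} {b} {Q} {L} a2Q≤L b2Q≤L = *-cancelʳ-≤ _ _ 2 (begin
      (a + b) * Q * 2           ≡⟨ identity a b Q ⟩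
      a * (2 * Q) + b * (2 * Q) ≤⟨ +-mono-≤ a2Q≤L b2Q≤L ⟩
      L + L                     ≡⟨ +-*-two L ⟩
      L * 2                     ∎)
      where
      open ≤-Reasoning
      identity : ∀ a b Q → (a + b) * Q * 2 ≡ a * (2 * Q) + b * (2 * Q)
      identity = solve-∀
      +-*-two : ∀ L → L + L ≡ L * 2
      +-*-two = solve-∀

    -- x, y agree off a set of size z, and y is periodic up to M²
    transfer-upper : ∀ {x y z w M} → x ≤ y + z → y * M ≤ w + M * M → x * M ≤ w + (M + z) * M
    transfer-upper {x} {y} {z} {w} {M} x≤y+z yM≤w+M² = begin
      x * M               ≤⟨ *-monoˡ-≤ M x≤y+z ⟩
      (y + z) * M         ≡⟨ *-distribʳ-+ M y z ⟩
      y * M + z * M       ≤⟨ +-monoˡ-≤ (z * M) yM≤w+M² ⟩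
      w + M * M + z * M   ≡⟨ identity w M z ⟩
      w + (M + z) * M     ∎
      where
      open ≤-Reasoning
      identity : ∀ w M z → w + M * M + z * M ≡ w + (M + z) * M
      identity = solve-∀

    transfer-lower : ∀ {x y z w M} → w ≤ y * M + M * M → y ≤ x + z → w ≤ x * M + (M + z) * M
    transfer-lower {x} {y} {z} {w} {M} w≤yM+M² y≤x+z = begin
      w                   ≤⟨ w≤yM+M² ⟩
      y * M + M * M       ≤⟨ +-monoˡ-≤ (M * M) (*-monoˡ-≤ M y≤x+z) ⟩
      (x + z) * M + M * M ≡⟨ identity x z M ⟩
      x * M + (M + z) * M ∎
      where
      open ≤-Reasoning
      identity : ∀ x z M → (x + z) * M + M * M ≡ x * M + (M + z) * M
      identity = solve-∀

  proportions-approximable : ∀ m → 2 ≤ m → ∀ K → ∃[ δ ] ∃[ N₀ ] ∀ N → N₀ ≤ N →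
                             Within ((+ 1) ℚ./ (2 * suc K)) (propH m N) δ
  proportions-approximable (suc k) (s≤s 0<k) K =
    (+ c) ℚ./ M , M * (2 * Q) , λ N N₀≤N →
      subst (λ x → Within _ x _) (sym (cong (λ x → (+ x) ℚ./ suc N) (countH≡count (suc k) (suc N))))
            (near (suc N) (m≤n⇒m≤1+n N₀≤N))
    where
    Q p C : ℕ
    Q = 2 * suc K
    p = 2 * (2 * Q)
    C = p * p
    open Truncation k p C

    c = count inClass? M

    exceptional·2Q≤ : ∀ L → count (exceptional? L) L * (2 * Q) ≤ L
    exceptional·2Q≤ L = ≤-trans (*-monoˡ-≤ (2 * Q) (count-exceptional L)) (halves {p * (L / 2 ^ suc C)} {L / P} {2 * Q} small large)
      where
      T = 2 ^ suc C
      small : p * (L / T) * p ≤ L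
      small = begin
        p * (L / T) * p  ≡⟨ trans (*-comm (p * (L / T)) p) (sym (*-assoc p p (L / T))) ⟩
        C * (L / T)      ≤⟨ *-monoˡ-≤ (L / T) (<⇒≤ (<-≤-trans (n<2^n C) (^-monoʳ-≤ 2 (n≤1+n C)))) ⟩
        T * (L / T)      ≡⟨ *-comm T (L / T) ⟩
        L / T * T        ≤⟨ m/n*n≤m L T ⟩
        L                ∎
        where open ≤-Reasoning
      large : L / P * p ≤ L
      large = ≤-trans (*-monoʳ-≤ (L / P) (n≤1+n p)) (m/n*n≤m L P)

    near : ∀ L .{{_ : NonZero L}} → M * (2 * Q) ≤ L → Within ((+ 1) ℚ./ Q) ((+ count height? L) ℚ./ L) ((+ c) ℚ./ M)
    near L M2Q≤L =
        /≤/+1/ cH L c M e Q (transfer-upper (count-height≤inClass+exceptional 0<k L) (proj₁ (count-residues L))) (eQ≤ (*-comm M L))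
      , /≤/+1/ c M cH L e Q (transfer-lower (proj₂ (count-residues L)) (count-inClass≤height+exceptional 0<k L)) (eQ≤ refl)
      where
      cH = count height? L
      cE = count (exceptional? L) L
      e  = (M + cE) * M
      eQ≤ : ∀ {LM} → M * L ≡ LM → e * Q ≤ LM
      eQ≤ refl = begin
        (M + cE) * M * Q  ≡⟨ trans (*-assoc (M + cE) M Q) (trans (cong ((M + cE) *_) (*-comm M Q)) (sym (*-assoc (M + cE) Q M))) ⟩
        (M + cE) * Q * M  ≤⟨ *-monoˡ-≤ M (halves {M} {cE} {Q} M2Q≤L (exceptional·2Q≤ L)) ⟩
        L * M             ≡⟨ *-comm L M ⟩
        M * L             ∎
        where open ≤-Reasoning

module MainTerm where

  open Counting
  open Fractions using (Within; /≤/; +/-distrib)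
  open import Data.Integer using (+_)
  import Data.Rational as ℚ
  import Data.Rational.Properties as ℚP
  open Valuations
  open Height
  open Existence using (countH≡count)
  open import Data.Nat
  open import Data.Nat.Properties
  open import Data.Nat.Divisibility
  open import Data.Nat.DivMod
  open import Data.Nat.Primality
  open import Data.Nat.Tactic.RingSolver using (solve-∀)
  open import Data.Product using (_×_; _,_; ∃-syntax; proj₁; proj₂)
  open import Data.Sum using (_⊎_; inj₁; inj₂)
  open import Function using (_∘_; case_of_)
  open import Relation.Binary.PropositionalEquality
  open import Relation.Nullary using (yes; no; ¬_)
  open import Relation.Nullary.Decidable using (toWitness)
  open import Relation.Unary using (Decidable)
  open import Relation.Unary.Properties using (_∪?_; _∩?_; ∁?)

  private
    /^[T+2]≤/^T/² : ∀ L {d e} T .{{_ : NonZero e}} .{{_ : NonZero d}} → e ≤ d →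
                   _/_ L (d ^ (T + 2)) {{m^n≢0 d (T + 2)}} ≤ _/_ (_/_ L (e ^ T) {{m^n≢0 e T}}) (d * d) {{m*n≢0 d d}}
    /^[T+2]≤/^T/² L {d} {e} T e≤d = begin
      L / d ^ (T + 2)          ≡⟨ /-congʳ (trans (^-distribˡ-+-* d T 2) (cong (λ x → d ^ T * (d * x)) (*-identityʳ d))) ⟩
      L / (d ^ T * (d * d))    ≤⟨ /-monoʳ-≤ L (*-monoˡ-≤ (d * d) (^-monoˡ-≤ T e≤d)) ⟩
      L / (e ^ T * (d * d))    ≡⟨ m/n/o≡m/[n*o] L (e ^ T) (d * d) ⟨
      L / e ^ T / (d * d)      ∎
      where
      open ≤-Reasoning
      instance
        _ = m^n≢0 d T
        _ = m^n≢0 e T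
        _ = m^n≢0 d (T + 2)
        _ = m*n≢0 d d
        _ = m*n≢0 (d ^ T) (d * d)
        _ = m*n≢0 (e ^ T) (d * d)

    3^n≤2^[2n] : ∀ n → 3 ^ n ≤ 2 ^ (2 * n)
    3^n≤2^[2n] n = ≤-trans (^-monoˡ-≤ n (n≤1+n 3)) (≤-reflexive (^-*-assoc 2 2 n))

    3^[n+2]≤3*4^n : ∀ n → 4 ≤ n → 3 ^ (n + 2) ≤ 3 * 4 ^ n
    3^[n+2]≤3*4^n 4 _ = toWitness {a? = 3 ^ 6 ≤? 3 * 4 ^ 4} _
    3^[n+2]≤3*4^n (suc n) 4≤1+n with m≤n⇒m<n∨m≡n 4≤1+n
    ... | inj₂ refl  = toWitness {a? = 3 ^ 6 ≤? 3 * 4 ^ 4} _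
    ... | inj₁ 4<1+n = ≤-trans (*-monoʳ-≤ 3 (3^[n+2]≤3*4^n n (s≤s⁻¹ 4<1+n)))
                               (≤-trans (≤-reflexive (x*[y*z]≡y*[x*z] 3 3 (4 ^ n))) (*-monoʳ-≤ 3 (*-monoˡ-≤ (4 ^ n) (n≤1+n 3))))
      where
      x*[y*z]≡y*[x*z] : ∀ x y z → x * (y * z) ≡ y * (x * z)
      x*[y*z]≡y*[x*z] = solve-∀

    3^n≤3*4^[n∸2] : ∀ {n} → 6 ≤ n → 3 ^ n ≤ 3 * 4 ^ (n ∸ 2)
    3^n≤3*4^[n∸2] {n} 6≤n = subst (λ m → 3 ^ m ≤ 3 * 4 ^ (n ∸ 2)) (m∸n+n≡m (≤-trans (m≤m+n 2 4) 6≤n))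
                                  (3^[n+2]≤3*4^n (n ∸ 2) (∸-monoˡ-≤ 2 6≤n))

    2n+2≤2^n : ∀ n → 4 ≤ n → 2 * n + 2 ≤ 2 ^ n
    2n+2≤2^n 4 _ = toWitness {a? = 2 * 4 + 2 ≤? 2 ^ 4} _
    2n+2≤2^n (suc n) 4≤1+n with m≤n⇒m<n∨m≡n 4≤1+n
    ... | inj₂ refl  = toWitness {a? = 2 * 4 + 2 ≤? 2 ^ 4} _
    ... | inj₁ 4<1+n = begin
      2 * suc n + 2       ≡⟨ identity n ⟩
      (2 * n + 2) + 2     ≤⟨ +-mono-≤ (2n+2≤2^n n (s≤s⁻¹ 4<1+n)) (^-monoʳ-≤ 2 {1} {n} (<-trans (s≤s z≤n) (s≤s⁻¹ 4<1+n))) ⟩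
      2 ^ n + 2 ^ n       ≡⟨ +-*-two (2 ^ n) ⟩
      2 ^ suc n           ∎
      where
      open ≤-Reasoning
      identity : ∀ n → 2 * suc n + 2 ≡ (2 * n + 2) + 2
      identity = solve-∀
      +-*-two : ∀ x → x + x ≡ 2 * x
      +-*-two = solve-∀

    3^n≤3*2^[2^n∸2] : ∀ {n} → 4 ≤ n → 3 ^ n ≤ 3 * 2 ^ (2 ^ n ∸ 2)
    3^n≤3*2^[2^n∸2] {n} 4≤n = ≤-trans (3^n≤2^[2n] n) (≤-trans (^-monoʳ-≤ 2 2n≤2^n∸2) (m≤n*m _ 3))
      where
      2n≤2^n∸2 : 2 * n ≤ 2 ^ n ∸ 2
      2n≤2^n∸2 = subst (_≤ 2 ^ n ∸ 2) (m+n∸n≡m (2 * n) 2) (∸-monoˡ-≤ 2 (2n+2≤2^n n 4≤n))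

    2↑↑-mono-≤ : ∀ {j k} → j ≤ k → 2 ↑↑ j ≤ 2 ↑↑ k
    2↑↑-mono-≤ {k = zero}  z≤n = ≤-refl
    2↑↑-mono-≤ {k = suc k} j≤1+k with m≤n⇒m<n∨m≡n j≤1+k
    ... | inj₂ refl  = ≤-refl
    ... | inj₁ j<1+k = ≤-trans (2↑↑-mono-≤ (s≤s⁻¹ j<1+k)) (<⇒≤ (n<2^n (2 ↑↑ k)))

    ≤/⇒*≤ : ∀ {c L T D a} .{{_ : NonZero T}} → c ≤ L / T → D ≤ a * T → c * D ≤ a * L
    ≤/⇒*≤ {c} {L} {T} {D} {a} c≤L/T D≤aT = begin
      c * D            ≤⟨ *-mono-≤ c≤L/T D≤aT ⟩
      L / T * (a * T)  ≡⟨ x*[y*z]≡y*[x*z] (L / T) a T ⟩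
      a * (L / T * T)  ≤⟨ *-monoʳ-≤ a (m/n*n≤m L T) ⟩
      a * L            ∎
      where
      open ≤-Reasoning
      x*[y*z]≡y*[x*z] : ∀ x y z → x * (y * z) ≡ y * (x * z)
      x*[y*z]≡y*[x*z] = solve-∀

  module Bounds (k : ℕ) (2≤k : 2 ≤ k) (L : ℕ) where

    A B : ℕ
    A = 2 ↑↑ k
    B = 2 ^ A

    private
      0<k : 0 < k
      0<k = <-trans (s≤s z≤n) 2≤k

    exact? : Decidable (λ n → 2 ^ A ∣ n × ¬ 2 ^ suc A ∣ n)
    exact? = (2 ^ A ∣?_) ∩? ∁? (2 ^ suc A ∣?_)

    highPower? : Decidable (λ n → ∃[ i ] i < L × (2 + i) ^ B ∣ n)
    highPower? = ∃<? (λ i → (2 + i) ^ B ∣?_) L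

    height? : Decidable (λ n → H n ≡ suc k)
    height? n = H n ≟ suc k

    exact⇒H≡1+k : ∀ {n} → 0 < n → n ≤ L → 2 ^ A ∣ n → ¬ 2 ^ suc A ∣ n →
                  ¬ (∃[ i ] i < L × (2 + i) ^ B ∣ n) → H n ≡ suc k
    exact⇒H≡1+k {n} 0<n n≤L 2^A∣n 2^[1+A]∤n ¬highPower = ≤-antisym
      (H-val≤⇒H≤suc λ {q} pr q∣n → ≮⇒≥ λ k<H[val] → ¬highPower (q ∸ 2 ,
        ≤-trans (∸-monoˡ-< (s≤s (≤-trans (∣⇒≤ {{>-nonZero 0<n}} q∣n) n≤L)) (prime⇒≥2 pr)) (m∸n≤m L 1) ,
        subst (λ d → d ^ B ∣ n) (sym (m+[n∸m]≡n (prime⇒≥2 pr))) (k≤val⇒p^k∣n (2↑↑k≤ {suc k} (s≤s z≤n) k<H[val]))))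
      (≤H-val⇒suc≤H 0<n prime[2] 0<k (≤-reflexive (sym (trans (cong H val≡A) (H-2↑↑ 0<k)))))
      where
      val≡A : val 2 n ≡ A
      val≡A = ≤-antisym (p^[1+c]∤n⇒val≤c 2^[1+A]∤n) (p^k∣n⇒k≤val ≤-refl 0<n 2^A∣n)

    unusual? : Decidable (λ n → 2 ^ (2 * A) ∣ n ⊎ 3 ^ A ∣ n ⊎ ∃[ i ] i < L × (4 + i) ^ A ∣ n)
    unusual? = (2 ^ (2 * A) ∣?_) ∪? (3 ^ A ∣?_) ∪? ∃<? (λ i → (4 + i) ^ A ∣?_) L

    H≡1+k⇒exact⊎unusual : ∀ {n} → 0 < n → n ≤ L → H n ≡ suc k →
      (2 ^ A ∣ n × ¬ 2 ^ suc A ∣ n) ⊎ (2 ^ (2 * A) ∣ n ⊎ 3 ^ A ∣ n ⊎ ∃[ i ] i < L × (4 + i) ^ A ∣ n)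
    H≡1+k⇒exact⊎unusual {n} 0<n n≤L H≡1+k with suc≤H⇒≤H-val {n} 0<k (≤-reflexive (sym H≡1+k))
    ... | q , pr , q∣n , k≤H[val] with q ≟ 2 | q ≟ 3
    ...   | yes refl | _ with a≡2↑↑k⊎2*2↑↑k≤a 2≤k k≤H[val]
    ...     | inj₁ val≡A  = inj₁ (k≤val⇒p^k∣n (≤-reflexive (sym val≡A)) ,
                                  λ 2^[1+A]∣n → 1+n≰n (subst (suc A ≤_) val≡A (p^k∣n⇒k≤val ≤-refl 0<n 2^[1+A]∣n)))
    ...     | inj₂ 2A≤val = inj₂ (inj₁ (k≤val⇒p^k∣n 2A≤val))
    H≡1+k⇒exact⊎unusual {n} 0<n n≤L H≡1+k | q , pr , q∣n , k≤H[val] | no _ | yes refl =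
      inj₂ (inj₂ (inj₁ q^A∣n))
      where q^A∣n = k≤val⇒p^k∣n (2↑↑k≤ 0<k k≤H[val])
    H≡1+k⇒exact⊎unusual {n} 0<n n≤L H≡1+k | q , pr , q∣n , k≤H[val] | no q≢2 | no q≢3 =
      inj₂ (inj₂ (inj₂ (q ∸ 4 , ≤-trans (∸-monoˡ-< (s≤s (≤-trans (∣⇒≤ {{>-nonZero 0<n}} q∣n) n≤L)) 4≤q) (m∸n≤m L 3) ,
                        subst (λ d → d ^ A ∣ n) (sym (m+[n∸m]≡n 4≤q)) (k≤val⇒p^k∣n (2↑↑k≤ 0<k k≤H[val])))))
      where
      4≤q : 4 ≤ q
      4≤q = ≤∧≢⇒< (≤∧≢⇒< (prime⇒≥2 pr) (q≢2 ∘ sym)) (q≢3 ∘ sym)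

    count-exact≤height+highPower : count exact? L ≤ count height? L + count highPower? L
    count-exact≤height+highPower = count-cover exact? height? highPower? λ 0<n n≤L (2^A∣n , 2^[1+A]∤n) →
      case highPower? _ of λ where
        (yes highPower) → inj₂ highPower
        (no ¬highPower) → inj₁ (exact⇒H≡1+k 0<n n≤L 2^A∣n 2^[1+A]∤n ¬highPower)

    count-height≤exact+unusual : count height? L ≤ count exact? L + count unusual? L
    count-height≤exact+unusual = count-cover height? exact? unusual? λ 0<n n≤L → H≡1+k⇒exact⊎unusual 0<n n≤L

    private instance
      2^A≢0     = m^n≢0 2 A
      2^[1+A]≢0 = m^n≢0 2 (suc A)
      2^2A≢0    = m^n≢0 2 (2 * A)
      3^A≢0     = m^n≢0 3 A
      2^[B-2]≢0 = m^n≢0 2 (B ∸ 2)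
      4^[A-2]≢0 = m^n≢0 4 (A ∸ 2)

    private
      2≤A : 2 ≤ A
      2≤A = 2≤2↑↑ 0<k

      2≤B : 2 ≤ B
      2≤B = ≤-trans 2≤A (<⇒≤ (n<2^n A))

    count-exact : count exact? L + L / 2 ^ suc A ≡ L / 2 ^ A
    count-exact = begin
      count exact? L + L / 2 ^ suc A                   ≡⟨ cong (λ x → count exact? L + x) (count-∣ (2 ^ suc A) L) ⟨
      count exact? L + count (2 ^ suc A ∣?_) L         ≡⟨ count-∖ (2 ^ A ∣?_) (2 ^ suc A ∣?_) (∣-trans (p^m∣p^n 2 (n≤1+n A))) L ⟩
      count (2 ^ A ∣?_) L                              ≡⟨ count-∣ (2 ^ A) L ⟩
      L / 2 ^ A                                        ∎
      where open ≡-Reasoning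

    count-highPower : count highPower? L ≤ L / 2 ^ (B ∸ 2)
    count-highPower = begin
      count highPower? L                                        ≤⟨ count-∃<-∣ (λ i → (2 + i) ^ B) {{λ {i} → m^n≢0 (2 + i) B}} L L ⟩
      ∑[ i < L ] (_/_ L ((2 + i) ^ B) {{m^n≢0 (2 + i) B}})     ≤⟨ ∑<-mono L (λ {i} _ → term i) ⟩
      ∑[ i < L ] (X / ((2 + i) * (2 + i)))                      ≤⟨ ∑</square≤ X 0 L ⟩
      X / 1                                                     ≡⟨ n/1≡n X ⟩
      X                                                         ∎
      where
      open ≤-Reasoning
      X = L / 2 ^ (B ∸ 2)
      term : ∀ i → _/_ L ((2 + i) ^ B) {{m^n≢0 (2 + i) B}} ≤ X / ((2 + i) * (2 + i))
      term i = subst (λ b → _/_ L ((2 + i) ^ b) {{m^n≢0 (2 + i) b}} ≤ X / ((2 + i) * (2 + i))) (m∸n+n≡m 2≤B)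
                     (/^[T+2]≤/^T/² L (B ∸ 2) (s≤s (s≤s z≤n)))

    count-unusual : count unusual? L ≤ L / 2 ^ (2 * A) + (L / 3 ^ A + L / 4 ^ (A ∸ 2) / 3)
    count-unusual = ≤-trans (count-∪ _ _ L) (+-mono-≤ (≤-reflexive (count-∣ (2 ^ (2 * A)) L))
                    (≤-trans (count-∪ _ _ L) (+-mono-≤ (≤-reflexive (count-∣ (3 ^ A) L)) (begin
      count (∃<? (λ i → (4 + i) ^ A ∣?_) L) L                  ≤⟨ count-∃<-∣ (λ i → (4 + i) ^ A) {{λ {i} → m^n≢0 (4 + i) A}} L L ⟩
      ∑[ i < L ] (_/_ L ((4 + i) ^ A) {{m^n≢0 (4 + i) A}})     ≤⟨ ∑<-mono L (λ {i} _ → term i) ⟩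
      ∑[ i < L ] (X / ((4 + i) * (4 + i)))                      ≤⟨ ∑</square≤ X 2 L ⟩
      X / 3                                                     ∎))))
      where
      open ≤-Reasoning
      X = L / 4 ^ (A ∸ 2)
      term : ∀ i → _/_ L ((4 + i) ^ A) {{m^n≢0 (4 + i) A}} ≤ X / ((4 + i) * (4 + i))
      term i = subst (λ a → _/_ L ((4 + i) ^ a) {{m^n≢0 (4 + i) a}} ≤ X / ((4 + i) * (4 + i))) (m∸n+n≡m 2≤A)
                     (/^[T+2]≤/^T/² L (A ∸ 2) (m≤m+n 4 i))

    private
      y = L / 2 ^ suc A
      X = count exact? L

      y≤X≤1+y : y ≤ X × X ≤ suc y
      y≤X≤1+y = +-cancelʳ-≤ y y X (≤-trans 2y≤z (≤-reflexive (sym count-exact))) ,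
                s≤s⁻¹ (+-cancelʳ-< y X (suc (suc y)) (subst₂ _<_ (sym count-exact) (identity y) z<2[1+y]))
        where
        identity : ∀ y → 2 * suc y ≡ suc (suc y) + y
        identity = solve-∀
        2y≤z : y + y ≤ L / 2 ^ A
        2y≤z = *≤⇒≤/ (subst (_≤ L) (sym (identity₂ y (2 ^ A))) (m/n*n≤m L (2 ^ suc A)))
          where
          identity₂ : ∀ y x → (y + y) * x ≡ y * (2 * x)
          identity₂ = solve-∀
        z<2[1+y] : L / 2 ^ A < 2 * suc y
        z<2[1+y] = m<n*o⇒m/o<n (subst (L <_) (identity₃ y (2 ^ A)) (m<[1+m/n]*n L (2 ^ suc A)))
          where
          identity₃ : ∀ y x → suc y * (2 * x) ≡ 2 * suc y * x
          identity₃ = solve-∀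

    count-height≤y+unusual+1 : count height? L ≤ y + count unusual? L + 1
    count-height≤y+unusual+1 = ≤-trans count-height≤exact+unusual (≤-trans (+-monoˡ-≤ (count unusual? L) (proj₂ y≤X≤1+y))
                                                   (≤-reflexive (+-comm 1 (y + count unusual? L))))

    L≤[height+highPower+1]*2^[1+A] : 1 * L ≤ (count height? L + count highPower? L + 1) * 2 ^ suc A
    L≤[height+highPower+1]*2^[1+A] = ≤-trans (≤-reflexive (*-identityˡ L)) (<⇒≤ (<-≤-trans (m<[1+m/n]*n L (2 ^ suc A))
      (*-monoˡ-≤ (2 ^ suc A) (≤-trans (s≤s (≤-trans (proj₁ y≤X≤1+y) count-exact≤height+highPower)) (≤-reflexive (+-comm 1 _))))))

    highPower*3^A≤3L : count highPower? L * 3 ^ A ≤ 3 * L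
    highPower*3^A≤3L = ≤/⇒*≤ {a = 3} count-highPower (3^n≤3*2^[2^n∸2] (2↑↑-mono-≤ 2≤k))

    unusual*3^A≤3L : 3 ≤ k → count unusual? L * 3 ^ A ≤ 3 * L
    unusual*3^A≤3L 3≤k = begin
      count unusual? L * 3 ^ A                                     ≤⟨ *-monoˡ-≤ (3 ^ A) count-unusual ⟩
      (a + (b + c)) * 3 ^ A                                        ≡⟨ distrib a b c (3 ^ A) ⟩
      a * 3 ^ A + (b * 3 ^ A + c * 3 ^ A)                          ≤⟨ +-mono-≤ t₁ (+-mono-≤ t₂ t₃) ⟩
      1 * L + (1 * L + 1 * L)                                      ≡⟨ identity L ⟩
      3 * L                                                        ∎
      where
      open ≤-Reasoning
      instance _ = m*n≢0 (4 ^ (A ∸ 2)) 3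
      a = L / 2 ^ (2 * A)
      b = L / 3 ^ A
      c = L / 4 ^ (A ∸ 2) / 3
      6≤A : 6 ≤ A
      6≤A = ≤-trans (m≤m+n 6 10) (2↑↑-mono-≤ 3≤k)
      t₁ : a * 3 ^ A ≤ 1 * L
      t₁ = ≤/⇒*≤ {a = 1} ≤-refl (≤-trans (3^n≤2^[2n] A) (≤-reflexive (sym (*-identityˡ _))))
      t₂ : b * 3 ^ A ≤ 1 * L
      t₂ = ≤/⇒*≤ {a = 1} ≤-refl (≤-reflexive (sym (*-identityˡ _)))
      t₃ : c * 3 ^ A ≤ 1 * L
      t₃ = ≤/⇒*≤ {a = 1} (≤-reflexive (m/n/o≡m/[n*o] L (4 ^ (A ∸ 2)) 3))
             (≤-trans (3^n≤3*4^[n∸2] 6≤A) (≤-reflexive (trans (*-comm 3 (4 ^ (A ∸ 2))) (sym (*-identityˡ _)))))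
      distrib : ∀ a b c d → (a + (b + c)) * d ≡ a * d + (b * d + c * d)
      distrib = solve-∀
      identity : ∀ L → 1 * L + (1 * L + 1 * L) ≡ 3 * L
      identity = solve-∀

    near-mainTerm : 3 ≤ k → ∀ K .{{_ : NonZero K}} .{{_ : NonZero L}} → K ≤ L →
      Within ((+ 3) ℚ./ 3 ^ A ℚ.+ (+ 1) ℚ./ K) ((+ count height? L) ℚ./ L) ((+ 1) ℚ./ 2 ^ suc A)
    near-mainTerm 3≤k K K≤L = upper , lower
      where
      open ℚP.≤-Reasoning
      cH = count height? L
      U  = count unusual? L
      E  = count highPower? L
      1/L≤1/K : (+ 1) ℚ./ L ℚ.≤ (+ 1) ℚ./ K
      1/L≤1/K = /≤/ 1 L 1 K (*-monoʳ-≤ 1 K≤L)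
      y/L≤1/2^[1+A] : (+ y) ℚ./ L ℚ.≤ (+ 1) ℚ./ 2 ^ suc A
      y/L≤1/2^[1+A] = /≤/ y L 1 (2 ^ suc A) (≤-trans (m/n*n≤m L (2 ^ suc A)) (≤-reflexive (sym (*-identityˡ L))))
      U/L≤3/3^A : (+ U) ℚ./ L ℚ.≤ (+ 3) ℚ./ 3 ^ A
      U/L≤3/3^A = /≤/ U L 3 (3 ^ A) (unusual*3^A≤3L 3≤k)
      E/L≤3/3^A : (+ E) ℚ./ L ℚ.≤ (+ 3) ℚ./ 3 ^ A
      E/L≤3/3^A = /≤/ E L 3 (3 ^ A) highPower*3^A≤3L
      upper = begin
        (+ cH) ℚ./ L                                      ≤⟨ /≤/ cH L (y + U + 1) L (*-monoˡ-≤ L count-height≤y+unusual+1) ⟩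
        (+ (y + U + 1)) ℚ./ L                             ≡⟨ trans (+/-distrib (y + U) 1 L) (cong (ℚ._+ (+ 1) ℚ./ L) (+/-distrib y U L)) ⟩
        (+ y) ℚ./ L ℚ.+ (+ U) ℚ./ L ℚ.+ (+ 1) ℚ./ L        ≤⟨ ℚP.+-mono-≤ (ℚP.+-mono-≤ y/L≤1/2^[1+A] U/L≤3/3^A) 1/L≤1/K ⟩
        (+ 1) ℚ./ 2 ^ suc A ℚ.+ (+ 3) ℚ./ 3 ^ A ℚ.+ (+ 1) ℚ./ K   ≡⟨ ℚP.+-assoc ((+ 1) ℚ./ 2 ^ suc A) _ _ ⟩
        (+ 1) ℚ./ 2 ^ suc A ℚ.+ ((+ 3) ℚ./ 3 ^ A ℚ.+ (+ 1) ℚ./ K) ∎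
      lower = begin
        (+ 1) ℚ./ 2 ^ suc A                               ≤⟨ /≤/ 1 (2 ^ suc A) (cH + E + 1) L L≤[height+highPower+1]*2^[1+A] ⟩
        (+ (cH + E + 1)) ℚ./ L                            ≡⟨ trans (+/-distrib (cH + E) 1 L) (cong (ℚ._+ (+ 1) ℚ./ L) (+/-distrib cH E L)) ⟩
        (+ cH) ℚ./ L ℚ.+ (+ E) ℚ./ L ℚ.+ (+ 1) ℚ./ L       ≤⟨ ℚP.+-mono-≤ (ℚP.+-monoʳ-≤ ((+ cH) ℚ./ L) E/L≤3/3^A) 1/L≤1/K ⟩
        (+ cH) ℚ./ L ℚ.+ (+ 3) ℚ./ 3 ^ A ℚ.+ (+ 1) ℚ./ K  ≡⟨ ℚP.+-assoc ((+ cH) ℚ./ L) _ _ ⟩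
        (+ cH) ℚ./ L ℚ.+ ((+ 3) ℚ./ 3 ^ A ℚ.+ (+ 1) ℚ./ K) ∎

  proportions-near-mainTerm : ∀ m → 4 ≤ m → ∀ K N → K ≤ N →
    Within (errBound m ℚ.+ (+ 1) ℚ./ suc K) (propH m N) (mainTerm m)
  proportions-near-mainTerm (suc k) (s≤s 3≤k) K N K≤N =
    subst (λ c → Within (errBound (suc k) ℚ.+ (+ 1) ℚ./ suc K) ((+ c) ℚ./ suc N) (mainTerm (suc k)))
          (sym (countH≡count (suc k) (suc N)))
      (Bounds.near-mainTerm k (≤-trans (n≤1+n 2) 3≤k) (suc N) 3≤k (suc K) (s≤s K≤N))

open Fractions using (Within⇒∣-∣≤; Within-mono; 1/suc≤pos; cauchy-if-approximable)
open Existence using (proportions-approximable)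
open MainTerm using (proportions-near-mainTerm)
open import Data.Nat using (ℕ; _≤_; s≤s; z≤n)
open import Data.Nat.Properties using (≤-trans)
open import Data.Rational using (ℚ; 0ℚ; _<_; _-_; _+_; ∣_∣) renaming (_≤_ to _≤ℚ_)
open import Data.Rational.Properties using (+-monoʳ-≤)
open import Data.Product using (_×_; _,_; ∃-syntax)

lemma6 : ∀ (m : ℕ) → 4 ≤ m →
    (∀ (ε : ℚ) → 0ℚ < ε → ∃[ N₀ ] ∀ N N′ → N₀ ≤ N → N₀ ≤ N′ →
      ∣ propH m N - propH m N′ ∣ ≤ℚ ε)
    × (∀ (ε : ℚ) → 0ℚ < ε → ∃[ N₀ ] ∀ N → N₀ ≤ N →
      ∣ propH m N - mainTerm m ∣ ≤ℚ errBound m + ε)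
lemma6 m 4≤m = cauchy-if-approximable (propH m) (proportions-approximable m (≤-trans (s≤s (s≤s z≤n)) 4≤m))
             , λ ε 0<ε → let K , 1/K≤ε = 1/suc≤pos ε 0<ε in
                 K , λ N K≤N → Within⇒∣-∣≤ (Within-mono (+-monoʳ-≤ (errBound m) 1/K≤ε) (proportions-near-mainTerm m 4≤m K N K≤N))
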